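{- Let the vertices of the cycle $C_5$ be $v_0,\dots,v_4$ (with $v_i$ adjacent to $v_{i\pm1 \bmod 5}$). On $C_5\Box C_5$ define: $A_1$ with four pebbles on $(v_0,v_0)$ and two pebbles each on $(v_2,v_2)$ and $(v_3,v_3)$ (none elsewhere); $A_2$ with four pebbles each on $(v_0,v_0)$, $(v_2,v_2)$ and $(v_3,v_3)$ (none elsewhere); $A_4$ with four pebbles on each vertex $(v_i,v_{2i \bmod 5})$, $0\le i\le 4$ (none elsewhere). Then for each $t\in\{1,2,4\}$, $A_t$ is $t$-solvable on $C_5\Box C_5$.
   Context: A distribution on a graph $G=(V,E)$ is a function $D:V\to\mathbb{N}$. A pebbling move removes two pebbles from a vertex having at least two pebbles and places one pebble on a neighbor. A distribution $D$ is $t$-solvable if for every vertex $v$, some sequence of pebbling moves starting from $D$ results in a distribution with at least $t$ pebbles on $v$. $\Box$ denotes the Cartesian product of graphs. -}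

module Defs where

open import Data.Nat using (ℕ; zero; suc; _+_; _≤_; _∸_)
open import Data.Fin using (Fin; zero; suc; toℕ)
open import Data.Nat.DivMod using (_%_)
open import Data.Product using (_×_; _,_; ∃)
open import Data.Sum using (_⊎_)
open import Relation.Binary.PropositionalEquality using (_≡_; _≢_)
open import Relation.Nullary using (Dec; yes; no)
open import Data.Fin using (_≟_)
open import Relation.Binary.Construct.Closure.ReflexiveTransitive using (Star)

record Graph : Set₁ where
  field
    V   : Set
    Adj : V → V → Set
open Graph public

Distribution : Graph → Set
Distribution G = V G → ℕ

-- One pebbling move from u to a neighbour w: D' u = D u - 2, D' w = D w + 1,
-- all other vertices unchanged; requires D u ≥ 2 (and u ≠ w since adjacent
-- vertices in a simple graph are distinct).
record PebblingMove (G : Graph) (D D' : Distribution G) : Set where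
  field
    u w     : V G
    adj     : Adj G u w
    u≢w     : u ≢ w
    enough  : 2 ≤ D u
    at-u    : D' u ≡ D u ∸ 2
    at-w    : D' w ≡ D w + 1
    others  : ∀ x → x ≢ u → x ≢ w → D' x ≡ D x

Reachable : (G : Graph) → Distribution G → Distribution G → Set
Reachable G = Star (PebblingMove G)

Solvable : (G : Graph) → ℕ → Distribution G → Set
Solvable G t D = ∀ (r : V G) → ∃ λ D' → Reachable G D D' × (t ≤ D' r)

_□_ : Graph → Graph → Graph
G □ H = record
  { V   = V G × V H
  ; Adj = λ { (g , h) (g' , h') → (Adj G g g' × h ≡ h') ⊎ (g ≡ g' × Adj H h h') } }

cycleAdj : (n : ℕ) → Fin n → Fin n → Set
cycleAdj (suc n) i j = (toℕ j ≡ (suc (toℕ i)) % suc n) ⊎ (toℕ i ≡ (suc (toℕ j)) % suc n)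
cycleAdj zero () _

C : ℕ → Graph
C n = record { V = Fin n ; Adj = cycleAdj n }

C5□C5 : Graph
C5□C5 = C 5 □ C 5

at : Fin 5 × Fin 5 → ℕ → Fin 5 × Fin 5 → ℕ
at (a , b) k (x , y) with a ≟ x | b ≟ y
... | yes _ | yes _ = k
... | _     | _     = 0

v : ℕ → Fin 5
v 0 = zero
v 1 = suc zero
v 2 = suc (suc zero)
v 3 = suc (suc (suc zero))
v _ = suc (suc (suc (suc zero)))

A₁ : Distribution C5□C5
A₁ p = at (v 0 , v 0) 4 p + at (v 2 , v 2) 2 p + at (v 3 , v 3) 2 p

A₂ : Distribution C5□C5
A₂ p = at (v 0 , v 0) 4 p + at (v 2 , v 2) 4 p + at (v 3 , v 3) 4 p

-- A_4: 4 on each (v_i, v_{2i mod 5}): (0,0),(1,2),(2,4),(3,1),(4,3).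
A₄ : Distribution C5□C5
A₄ p = at (v 0 , v 0) 4 p + at (v 1 , v 2) 4 p + at (v 2 , v 4) 4 p
     + at (v 3 , v 1) 4 p + at (v 4 , v 3) 4 p

-- A distribution is certified t-solvable by exhibiting, for every target vertex, an explicit
-- sequence of pebbling moves; a checker that replays the sequence and confirms that every move is
-- legal and that t pebbles end on the target is proved sound once, for any graph with decidable
-- equality and adjacency.  Each plan gathers pebbles at the target along shortest paths, a vertex
-- holding 4 pebbles contributing 2 to a neighbour or 1 to a vertex at distance two.
module Submission where

open import Defs
open import Data.Bool using (T)
open import Data.Fin using (toℕ)
open import Data.Fin.Properties using (all?)
open import Data.List using (List; []; _∷_)
open import Data.Maybe using (Maybe; just; nothing; is-just)
open import Data.Nat using (ℕ; suc; _+_; _≤_; _∸_; _≤?_)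
open import Data.Nat.DivMod using (_%_)
import Data.Nat.Properties as ℕ
open import Data.Product using (Σ; ∃; _×_; _,_)
open import Data.Product.Properties using (≡-dec)
open import Relation.Binary.Definitions using (Decidable; DecidableEquality)
open import Relation.Binary.PropositionalEquality using (_≡_; _≢_; refl; sym)
open import Relation.Binary.Construct.Closure.ReflexiveTransitive using (ε; _◅_)
open import Relation.Nullary using (yes; no; contradiction)
open import Relation.Nullary.Decidable using (_×-dec_; _⊎-dec_; True; toWitness; T?)
import Data.Fin as Fin

fromJust : {A : Set} (m : Maybe A) → T (is-just m) → A
fromJust (just x) _ = x

module Certificates (G : Graph) (_≟_ : DecidableEquality (V G)) (adj? : Decidable (Adj G)) where

  Move : Set
  Move = V G × V G

  fire : Distribution G → V G → V G → Distribution G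
  fire D u w x with x ≟ u | x ≟ w
  ... | yes _ | _     = D u ∸ 2
  ... | no _  | yes _ = D w + 1
  ... | no _  | no _  = D x

  fire-source : ∀ D u w → fire D u w u ≡ D u ∸ 2
  fire-source D u w with u ≟ u
  ... | yes _  = refl
  ... | no u≢u = contradiction refl u≢u

  fire-target : ∀ D {u w} → u ≢ w → fire D u w w ≡ D w + 1
  fire-target D {u} {w} u≢w with w ≟ u | w ≟ w
  ... | yes w≡u | _      = contradiction (sym w≡u) u≢w
  ... | no _    | yes _  = refl
  ... | no _    | no w≢w = contradiction refl w≢w

  fire-other : ∀ D u w x → x ≢ u → x ≢ w → fire D u w x ≡ D x
  fire-other D u w x x≢u x≢w with x ≟ u | x ≟ w
  ... | yes x≡u | _       = contradiction x≡u x≢u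
  ... | no _    | yes x≡w = contradiction x≡w x≢w
  ... | no _    | no _    = refl

  fire-isPebblingMove : ∀ D {u w} → Adj G u w → u ≢ w → 2 ≤ D u → PebblingMove G D (fire D u w)
  fire-isPebblingMove D {u} {w} u~w u≢w 2≤Du = record
    { u = u ; w = w ; adj = u~w ; u≢w = u≢w ; enough = 2≤Du
    ; at-u = fire-source D u w ; at-w = fire-target D u≢w ; others = fire-other D u w }

  tryMove : (D : Distribution G) → Move → Maybe (Σ (Distribution G) (PebblingMove G D))
  tryMove D (u , w) with adj? u w | u ≟ w | 2 ≤? D u
  ... | yes u~w | no u≢w | yes 2≤Du = just (fire D u w , fire-isPebblingMove D u~w u≢w 2≤Du)
  ... | _       | _      | _        = nothing

  play : (D : Distribution G) → List Move → Maybe (Σ (Distribution G) (Reachable G D))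
  play D []       = just (D , ε)
  play D (m ∷ ms) with tryMove D m
  ... | nothing       = nothing
  ... | just (D₁ , s) with play D₁ ms
  ...   | nothing        = nothing
  ...   | just (D₂ , ss) = just (D₂ , s ◅ ss)

  delivers : (t : ℕ) (D : Distribution G) (r : V G) → List Move →
             Maybe (∃ λ D' → Reachable G D D' × t ≤ D' r)
  delivers t D r ms with play D ms
  ... | nothing       = nothing
  ... | just (D' , ss) with t ≤? D' r
  ...   | yes t≤D'r = just (D' , ss , t≤D'r)
  ...   | no _      = nothing

  solvable-by-plans : ∀ t D (plan : V G → List Move) →
                      (∀ r → T (is-just (delivers t D r (plan r)))) → Solvable G t D
  solvable-by-plans t D plan succeeds r = fromJust (delivers t D r (plan r)) (succeeds r)

cycleAdj? : ∀ n → Decidable (cycleAdj (suc n))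
cycleAdj? n i j = (toℕ j ℕ.≟ suc (toℕ i) % suc n) ⊎-dec (toℕ i ℕ.≟ suc (toℕ j) % suc n)

□-adj? : ∀ G H → DecidableEquality (V G) → DecidableEquality (V H) →
         Decidable (Adj G) → Decidable (Adj H) → Decidable (Adj (G □ H))
□-adj? G H _≟G_ _≟H_ adjG? adjH? (g , h) (g' , h') =
  (adjG? g g' ×-dec (h ≟H h')) ⊎-dec ((g ≟G g') ×-dec adjH? h h')

open Certificates C5□C5 (≡-dec Fin._≟_ Fin._≟_)
  (□-adj? (C 5) (C 5) Fin._≟_ Fin._≟_ (cycleAdj? 4) (cycleAdj? 4))

infix 6 _⇒_

_⇒_ : ℕ × ℕ → ℕ × ℕ → Move
(i , j) ⇒ (k , l) = ((v i , v j) , (v k , v l))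

solvable-by-grid-plans : ∀ t D (plan : ℕ → ℕ → List Move) →
  True (all? λ i → all? λ j → T? (is-just (delivers t D (i , j) (plan (toℕ i) (toℕ j))))) →
  Solvable C5□C5 t D
solvable-by-grid-plans t D plan succeeds =
  solvable-by-plans t D (λ (i , j) → plan (toℕ i) (toℕ j)) (λ (i , j) → toWitness succeeds i j)

-- Targets without a clause already hold t pebbles.
plan₁ : ℕ → ℕ → List Move
plan₁ 0 1 = (0 , 0) ⇒ (0 , 1) ∷ []
plan₁ 0 2 = (0 , 0) ⇒ (0 , 1) ∷ (0 , 0) ⇒ (0 , 1) ∷ (0 , 1) ⇒ (0 , 2) ∷ []
plan₁ 0 3 = (0 , 0) ⇒ (0 , 4) ∷ (0 , 0) ⇒ (0 , 4) ∷ (0 , 4) ⇒ (0 , 3) ∷ []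
plan₁ 0 4 = (0 , 0) ⇒ (0 , 4) ∷ []
plan₁ 1 0 = (0 , 0) ⇒ (1 , 0) ∷ []
plan₁ 1 1 = (0 , 0) ⇒ (1 , 0) ∷ (0 , 0) ⇒ (1 , 0) ∷ (1 , 0) ⇒ (1 , 1) ∷ []
plan₁ 1 2 = (2 , 2) ⇒ (1 , 2) ∷ []
plan₁ 1 3 = (2 , 2) ⇒ (2 , 3) ∷ (3 , 3) ⇒ (2 , 3) ∷ (2 , 3) ⇒ (1 , 3) ∷ []
plan₁ 1 4 = (0 , 0) ⇒ (1 , 0) ∷ (0 , 0) ⇒ (1 , 0) ∷ (1 , 0) ⇒ (1 , 4) ∷ []
plan₁ 2 0 = (0 , 0) ⇒ (1 , 0) ∷ (0 , 0) ⇒ (1 , 0) ∷ (1 , 0) ⇒ (2 , 0) ∷ []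
plan₁ 2 1 = (2 , 2) ⇒ (2 , 1) ∷ []
plan₁ 2 3 = (2 , 2) ⇒ (2 , 3) ∷ []
plan₁ 2 4 = (2 , 2) ⇒ (2 , 3) ∷ (3 , 3) ⇒ (2 , 3) ∷ (2 , 3) ⇒ (2 , 4) ∷ []
plan₁ 3 0 = (0 , 0) ⇒ (4 , 0) ∷ (0 , 0) ⇒ (4 , 0) ∷ (4 , 0) ⇒ (3 , 0) ∷ []
plan₁ 3 1 = (2 , 2) ⇒ (3 , 2) ∷ (3 , 3) ⇒ (3 , 2) ∷ (3 , 2) ⇒ (3 , 1) ∷ []
plan₁ 3 2 = (2 , 2) ⇒ (3 , 2) ∷ []
plan₁ 3 4 = (3 , 3) ⇒ (3 , 4) ∷ []
plan₁ 4 0 = (0 , 0) ⇒ (4 , 0) ∷ []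
plan₁ 4 1 = (0 , 0) ⇒ (4 , 0) ∷ (0 , 0) ⇒ (4 , 0) ∷ (4 , 0) ⇒ (4 , 1) ∷ []
plan₁ 4 2 = (2 , 2) ⇒ (3 , 2) ∷ (3 , 3) ⇒ (3 , 2) ∷ (3 , 2) ⇒ (4 , 2) ∷ []
plan₁ 4 3 = (3 , 3) ⇒ (4 , 3) ∷ []
plan₁ 4 4 = (0 , 0) ⇒ (4 , 0) ∷ (0 , 0) ⇒ (4 , 0) ∷ (4 , 0) ⇒ (4 , 4) ∷ []
plan₁ _ _ = []

plan₂ : ℕ → ℕ → List Move
plan₂ 0 1 = (0 , 0) ⇒ (0 , 1) ∷ (0 , 0) ⇒ (0 , 1) ∷ []
plan₂ 0 2 =
  (0 , 0) ⇒ (0 , 1) ∷ (0 , 0) ⇒ (0 , 1) ∷ (0 , 1) ⇒ (0 , 2) ∷ (2 , 2) ⇒ (1 , 2) ∷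
  (2 , 2) ⇒ (1 , 2) ∷ (1 , 2) ⇒ (0 , 2) ∷ []
plan₂ 0 3 =
  (0 , 0) ⇒ (0 , 4) ∷ (0 , 0) ⇒ (0 , 4) ∷ (0 , 4) ⇒ (0 , 3) ∷ (3 , 3) ⇒ (4 , 3) ∷
  (3 , 3) ⇒ (4 , 3) ∷ (4 , 3) ⇒ (0 , 3) ∷ []
plan₂ 0 4 = (0 , 0) ⇒ (0 , 4) ∷ (0 , 0) ⇒ (0 , 4) ∷ []
plan₂ 1 0 = (0 , 0) ⇒ (1 , 0) ∷ (0 , 0) ⇒ (1 , 0) ∷ []
plan₂ 1 1 =
  (0 , 0) ⇒ (1 , 0) ∷ (0 , 0) ⇒ (1 , 0) ∷ (1 , 0) ⇒ (1 , 1) ∷ (2 , 2) ⇒ (1 , 2) ∷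
  (2 , 2) ⇒ (1 , 2) ∷ (1 , 2) ⇒ (1 , 1) ∷ []
plan₂ 1 2 = (2 , 2) ⇒ (1 , 2) ∷ (2 , 2) ⇒ (1 , 2) ∷ []
plan₂ 1 3 =
  (2 , 2) ⇒ (1 , 2) ∷ (2 , 2) ⇒ (1 , 2) ∷ (1 , 2) ⇒ (1 , 3) ∷ (3 , 3) ⇒ (2 , 3) ∷
  (3 , 3) ⇒ (2 , 3) ∷ (2 , 3) ⇒ (1 , 3) ∷ []
plan₂ 1 4 =
  (0 , 0) ⇒ (1 , 0) ∷ (0 , 0) ⇒ (1 , 0) ∷ (1 , 0) ⇒ (1 , 4) ∷ (2 , 2) ⇒ (1 , 2) ∷
  (2 , 2) ⇒ (1 , 2) ∷ (1 , 2) ⇒ (1 , 3) ∷ (3 , 3) ⇒ (2 , 3) ∷ (3 , 3) ⇒ (2 , 3) ∷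
  (2 , 3) ⇒ (1 , 3) ∷ (1 , 3) ⇒ (1 , 4) ∷ []
plan₂ 2 0 =
  (0 , 0) ⇒ (1 , 0) ∷ (0 , 0) ⇒ (1 , 0) ∷ (1 , 0) ⇒ (2 , 0) ∷ (2 , 2) ⇒ (2 , 1) ∷
  (2 , 2) ⇒ (2 , 1) ∷ (2 , 1) ⇒ (2 , 0) ∷ []
plan₂ 2 1 = (2 , 2) ⇒ (2 , 1) ∷ (2 , 2) ⇒ (2 , 1) ∷ []
plan₂ 2 3 = (2 , 2) ⇒ (2 , 3) ∷ (2 , 2) ⇒ (2 , 3) ∷ []
plan₂ 2 4 =
  (2 , 2) ⇒ (2 , 3) ∷ (2 , 2) ⇒ (2 , 3) ∷ (2 , 3) ⇒ (2 , 4) ∷ (3 , 3) ⇒ (2 , 3) ∷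
  (3 , 3) ⇒ (2 , 3) ∷ (2 , 3) ⇒ (2 , 4) ∷ []
plan₂ 3 0 =
  (0 , 0) ⇒ (4 , 0) ∷ (0 , 0) ⇒ (4 , 0) ∷ (3 , 3) ⇒ (3 , 4) ∷ (3 , 3) ⇒ (3 , 4) ∷
  (3 , 4) ⇒ (3 , 0) ∷ (4 , 0) ⇒ (3 , 0) ∷ []
plan₂ 3 1 =
  (2 , 2) ⇒ (3 , 2) ∷ (2 , 2) ⇒ (3 , 2) ∷ (3 , 2) ⇒ (3 , 1) ∷ (3 , 3) ⇒ (3 , 2) ∷
  (3 , 3) ⇒ (3 , 2) ∷ (3 , 2) ⇒ (3 , 1) ∷ []
plan₂ 3 2 = (2 , 2) ⇒ (3 , 2) ∷ (2 , 2) ⇒ (3 , 2) ∷ []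
plan₂ 3 4 = (3 , 3) ⇒ (3 , 4) ∷ (3 , 3) ⇒ (3 , 4) ∷ []
plan₂ 4 0 = (0 , 0) ⇒ (4 , 0) ∷ (0 , 0) ⇒ (4 , 0) ∷ []
plan₂ 4 1 =
  (0 , 0) ⇒ (4 , 0) ∷ (0 , 0) ⇒ (4 , 0) ∷ (2 , 2) ⇒ (3 , 2) ∷ (2 , 2) ⇒ (3 , 2) ∷
  (3 , 2) ⇒ (4 , 2) ∷ (3 , 3) ⇒ (4 , 3) ∷ (3 , 3) ⇒ (4 , 3) ∷ (4 , 0) ⇒ (4 , 1) ∷
  (4 , 3) ⇒ (4 , 2) ∷ (4 , 2) ⇒ (4 , 1) ∷ []
plan₂ 4 2 =
  (2 , 2) ⇒ (3 , 2) ∷ (2 , 2) ⇒ (3 , 2) ∷ (3 , 2) ⇒ (4 , 2) ∷ (3 , 3) ⇒ (4 , 3) ∷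
  (3 , 3) ⇒ (4 , 3) ∷ (4 , 3) ⇒ (4 , 2) ∷ []
plan₂ 4 3 = (3 , 3) ⇒ (4 , 3) ∷ (3 , 3) ⇒ (4 , 3) ∷ []
plan₂ 4 4 =
  (0 , 0) ⇒ (4 , 0) ∷ (0 , 0) ⇒ (4 , 0) ∷ (3 , 3) ⇒ (4 , 3) ∷ (3 , 3) ⇒ (4 , 3) ∷
  (4 , 0) ⇒ (4 , 4) ∷ (4 , 3) ⇒ (4 , 4) ∷ []
plan₂ _ _ = []

plan₄ : ℕ → ℕ → List Move
plan₄ 0 1 =
  (0 , 0) ⇒ (0 , 1) ∷ (0 , 0) ⇒ (0 , 1) ∷ (1 , 2) ⇒ (0 , 2) ∷ (1 , 2) ⇒ (0 , 2) ∷
  (0 , 2) ⇒ (0 , 1) ∷ (3 , 1) ⇒ (4 , 1) ∷ (3 , 1) ⇒ (4 , 1) ∷ (4 , 1) ⇒ (0 , 1) ∷ []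
plan₄ 0 2 =
  (0 , 0) ⇒ (0 , 1) ∷ (0 , 0) ⇒ (0 , 1) ∷ (0 , 1) ⇒ (0 , 2) ∷ (1 , 2) ⇒ (0 , 2) ∷
  (1 , 2) ⇒ (0 , 2) ∷ (4 , 3) ⇒ (0 , 3) ∷ (4 , 3) ⇒ (0 , 3) ∷ (0 , 3) ⇒ (0 , 2) ∷ []
plan₄ 0 3 =
  (0 , 0) ⇒ (0 , 4) ∷ (0 , 0) ⇒ (0 , 4) ∷ (0 , 4) ⇒ (0 , 3) ∷ (1 , 2) ⇒ (0 , 2) ∷
  (1 , 2) ⇒ (0 , 2) ∷ (0 , 2) ⇒ (0 , 3) ∷ (4 , 3) ⇒ (0 , 3) ∷ (4 , 3) ⇒ (0 , 3) ∷ []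
plan₄ 0 4 =
  (0 , 0) ⇒ (0 , 4) ∷ (0 , 0) ⇒ (0 , 4) ∷ (2 , 4) ⇒ (1 , 4) ∷ (2 , 4) ⇒ (1 , 4) ∷
  (1 , 4) ⇒ (0 , 4) ∷ (4 , 3) ⇒ (0 , 3) ∷ (4 , 3) ⇒ (0 , 3) ∷ (0 , 3) ⇒ (0 , 4) ∷ []
plan₄ 1 0 =
  (0 , 0) ⇒ (1 , 0) ∷ (0 , 0) ⇒ (1 , 0) ∷ (1 , 2) ⇒ (1 , 1) ∷ (1 , 2) ⇒ (1 , 1) ∷
  (1 , 1) ⇒ (1 , 0) ∷ (2 , 4) ⇒ (1 , 4) ∷ (2 , 4) ⇒ (1 , 4) ∷ (1 , 4) ⇒ (1 , 0) ∷ []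
plan₄ 1 1 =
  (0 , 0) ⇒ (1 , 0) ∷ (0 , 0) ⇒ (1 , 0) ∷ (1 , 0) ⇒ (1 , 1) ∷ (1 , 2) ⇒ (1 , 1) ∷
  (1 , 2) ⇒ (1 , 1) ∷ (3 , 1) ⇒ (2 , 1) ∷ (3 , 1) ⇒ (2 , 1) ∷ (2 , 1) ⇒ (1 , 1) ∷ []
plan₄ 1 3 =
  (1 , 2) ⇒ (1 , 3) ∷ (1 , 2) ⇒ (1 , 3) ∷ (2 , 4) ⇒ (1 , 4) ∷ (2 , 4) ⇒ (1 , 4) ∷
  (1 , 4) ⇒ (1 , 3) ∷ (4 , 3) ⇒ (0 , 3) ∷ (4 , 3) ⇒ (0 , 3) ∷ (0 , 3) ⇒ (1 , 3) ∷ []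
plan₄ 1 4 =
  (0 , 0) ⇒ (1 , 0) ∷ (0 , 0) ⇒ (1 , 0) ∷ (1 , 0) ⇒ (1 , 4) ∷ (1 , 2) ⇒ (1 , 3) ∷
  (1 , 2) ⇒ (1 , 3) ∷ (1 , 3) ⇒ (1 , 4) ∷ (2 , 4) ⇒ (1 , 4) ∷ (2 , 4) ⇒ (1 , 4) ∷ []
plan₄ 2 0 =
  (0 , 0) ⇒ (1 , 0) ∷ (0 , 0) ⇒ (1 , 0) ∷ (1 , 0) ⇒ (2 , 0) ∷ (2 , 4) ⇒ (2 , 0) ∷
  (2 , 4) ⇒ (2 , 0) ∷ (3 , 1) ⇒ (2 , 1) ∷ (3 , 1) ⇒ (2 , 1) ∷ (2 , 1) ⇒ (2 , 0) ∷ []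
plan₄ 2 1 =
  (1 , 2) ⇒ (2 , 2) ∷ (1 , 2) ⇒ (2 , 2) ∷ (2 , 2) ⇒ (2 , 1) ∷ (2 , 4) ⇒ (2 , 0) ∷
  (2 , 4) ⇒ (2 , 0) ∷ (2 , 0) ⇒ (2 , 1) ∷ (3 , 1) ⇒ (2 , 1) ∷ (3 , 1) ⇒ (2 , 1) ∷ []
plan₄ 2 2 =
  (1 , 2) ⇒ (2 , 2) ∷ (1 , 2) ⇒ (2 , 2) ∷ (2 , 4) ⇒ (2 , 3) ∷ (2 , 4) ⇒ (2 , 3) ∷
  (2 , 3) ⇒ (2 , 2) ∷ (3 , 1) ⇒ (2 , 1) ∷ (3 , 1) ⇒ (2 , 1) ∷ (2 , 1) ⇒ (2 , 2) ∷ []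
plan₄ 2 3 =
  (1 , 2) ⇒ (2 , 2) ∷ (1 , 2) ⇒ (2 , 2) ∷ (2 , 2) ⇒ (2 , 3) ∷ (2 , 4) ⇒ (2 , 3) ∷
  (2 , 4) ⇒ (2 , 3) ∷ (4 , 3) ⇒ (3 , 3) ∷ (4 , 3) ⇒ (3 , 3) ∷ (3 , 3) ⇒ (2 , 3) ∷ []
plan₄ 3 0 =
  (0 , 0) ⇒ (4 , 0) ∷ (0 , 0) ⇒ (4 , 0) ∷ (2 , 4) ⇒ (3 , 4) ∷ (2 , 4) ⇒ (3 , 4) ∷
  (3 , 1) ⇒ (3 , 0) ∷ (3 , 1) ⇒ (3 , 0) ∷ (3 , 4) ⇒ (3 , 0) ∷ (4 , 0) ⇒ (3 , 0) ∷ []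
plan₄ 3 2 =
  (1 , 2) ⇒ (2 , 2) ∷ (1 , 2) ⇒ (2 , 2) ∷ (2 , 2) ⇒ (3 , 2) ∷ (3 , 1) ⇒ (3 , 2) ∷
  (3 , 1) ⇒ (3 , 2) ∷ (4 , 3) ⇒ (3 , 3) ∷ (4 , 3) ⇒ (3 , 3) ∷ (3 , 3) ⇒ (3 , 2) ∷ []
plan₄ 3 3 =
  (2 , 4) ⇒ (3 , 4) ∷ (2 , 4) ⇒ (3 , 4) ∷ (3 , 1) ⇒ (3 , 2) ∷ (3 , 1) ⇒ (3 , 2) ∷
  (3 , 2) ⇒ (3 , 3) ∷ (3 , 4) ⇒ (3 , 3) ∷ (4 , 3) ⇒ (3 , 3) ∷ (4 , 3) ⇒ (3 , 3) ∷ []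
plan₄ 3 4 =
  (2 , 4) ⇒ (3 , 4) ∷ (2 , 4) ⇒ (3 , 4) ∷ (3 , 1) ⇒ (3 , 0) ∷ (3 , 1) ⇒ (3 , 0) ∷
  (3 , 0) ⇒ (3 , 4) ∷ (4 , 3) ⇒ (3 , 3) ∷ (4 , 3) ⇒ (3 , 3) ∷ (3 , 3) ⇒ (3 , 4) ∷ []
plan₄ 4 0 =
  (0 , 0) ⇒ (4 , 0) ∷ (0 , 0) ⇒ (4 , 0) ∷ (3 , 1) ⇒ (4 , 1) ∷ (3 , 1) ⇒ (4 , 1) ∷
  (4 , 1) ⇒ (4 , 0) ∷ (4 , 3) ⇒ (4 , 4) ∷ (4 , 3) ⇒ (4 , 4) ∷ (4 , 4) ⇒ (4 , 0) ∷ []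
plan₄ 4 1 =
  (0 , 0) ⇒ (4 , 0) ∷ (0 , 0) ⇒ (4 , 0) ∷ (3 , 1) ⇒ (4 , 1) ∷ (3 , 1) ⇒ (4 , 1) ∷
  (4 , 0) ⇒ (4 , 1) ∷ (4 , 3) ⇒ (4 , 2) ∷ (4 , 3) ⇒ (4 , 2) ∷ (4 , 2) ⇒ (4 , 1) ∷ []
plan₄ 4 2 =
  (1 , 2) ⇒ (0 , 2) ∷ (1 , 2) ⇒ (0 , 2) ∷ (0 , 2) ⇒ (4 , 2) ∷ (3 , 1) ⇒ (4 , 1) ∷
  (3 , 1) ⇒ (4 , 1) ∷ (4 , 1) ⇒ (4 , 2) ∷ (4 , 3) ⇒ (4 , 2) ∷ (4 , 3) ⇒ (4 , 2) ∷ []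
plan₄ 4 4 =
  (0 , 0) ⇒ (4 , 0) ∷ (0 , 0) ⇒ (4 , 0) ∷ (2 , 4) ⇒ (3 , 4) ∷ (2 , 4) ⇒ (3 , 4) ∷
  (3 , 4) ⇒ (4 , 4) ∷ (4 , 0) ⇒ (4 , 4) ∷ (4 , 3) ⇒ (4 , 4) ∷ (4 , 3) ⇒ (4 , 4) ∷ []
plan₄ _ _ = []

proposition5p1 : Solvable C5□C5 1 A₁ × Solvable C5□C5 2 A₂ × Solvable C5□C5 4 A₄
proposition5p1 =
  solvable-by-grid-plans 1 A₁ plan₁ _ ,
  solvable-by-grid-plans 2 A₂ plan₂ _ ,
  solvable-by-grid-plans 4 A₄ plan₄ _
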